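{- Consider some canonical form of Boolean decision diagrams (DDs) with canonicity condition $K(\mathbf{A})$ on Boolean atom sets $\mathbf{A}$. Suppose a form of $\mathcal{T}$-DD with canonicity condition $K(\boldsymbol{\alpha})$ is defined, for all sets $\boldsymbol{\alpha}$ of $\mathcal{T}$-atoms, all sets $\boldsymbol{\beta}$ of extra $\mathcal{T}$-atoms not in $\boldsymbol{\alpha}$ (with Boolean abstractions $\mathbf{A}$, $\mathbf{B}$), and all $\mathcal{T}$-formulas $\varphi[\boldsymbol{\alpha}]$, by $$\mathcal{T}\text{ -DD}(\varphi[\boldsymbol{\alpha}]) := \mathcal{B}2\mathcal{T}\Big(\mathrm{DD}\Big(\varphi^p\wedge\exists\mathbf{B}.\!\!\bigwedge_{C_l\in\mathrm{TLEMMAS}_{\boldsymbol{\alpha},\boldsymbol{\beta}}(\varphi)}\!\!C_l^p\Big)\Big),$$ where $\exists\mathbf{B}$ is Boolean existential quantification. Then these $\mathcal{T}$-DDs are $\mathcal{T}$-canonical.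
   Context: All formulas are quantifier-free $\mathcal{T}$-formulas (Boolean combinations of ground $\mathcal{T}$-atoms, $\mathcal{T}$ a first-order theory). $\mathcal{T}2\mathcal{B}$ is the Boolean abstraction (bijection mapping Boolean atoms to themselves and other $\mathcal{T}$-atoms to fresh Boolean variables, homomorphic over connectives), $\mathcal{B}2\mathcal{T}$ its inverse, $\psi^p:=\mathcal{T}2\mathcal{B}(\psi)$. $\varphi[\boldsymbol{\alpha}]$ means $\varphi$ regarded over a set $\boldsymbol{\alpha}$ containing all its atoms. $\equiv_{\mathcal{T}}$ is equivalence modulo $\mathcal{T}$; $\equiv_{\mathcal{B}}$ is propositional equivalence of abstractions. Truth assignments are conjunctions of literals; total on $\boldsymbol{\alpha}$ means one literal per atom. $\mathrm{TTA}^{\neg\mathcal{T}}_{\boldsymbol{\alpha}}(\varphi)$ is the set of $\mathcal{T}$-inconsistent total truth assignments on $\boldsymbol{\alpha}$ propositionally satisfying $\varphi$. A $\mathcal{T}$-lemma is a $\mathcal{T}$-valid clause. A set $\{C_l\}$ of $\mathcal{T}$-lemmas on $\boldsymbol{\alpha}\cup\boldsymbol{\beta}$ rules out a set $\{\rho_j\}$ of $\mathcal{T}$-inconsistent total truth assignments on $\boldsymbol{\alpha}$ iff $\bigvee_j\rho_j\wedge\bigwedge_lC_l\equiv_{\mathcal{B}}\bot$. $\mathrm{TLEMMAS}_{\boldsymbol{\alpha},\boldsymbol{\beta}}(\varphi)$ denotes any function returning a set of $\mathcal{T}$-lemmas on $\boldsymbol{\alpha}\cup\boldsymbol{\beta}$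 which rules out $\mathrm{TTA}^{\neg\mathcal{T}}_{\boldsymbol{\alpha}}(\varphi)$. A form of DDs (e.g. OBDDs, SDDs) is canonical modulo condition $K(\mathbf{A})$ (e.g. variable order, v-tree) if, built under the same $K(\mathbf{A})$, each Boolean formula over $\mathbf{A}$ has a unique DD $\mathrm{DD}(\cdot)$ and two formulas have identical DDs iff they are equivalent. A form of $\mathcal{T}$-DD is $\mathcal{T}$-canonical w.r.t. $K(\boldsymbol{\alpha})$ if for all $\varphi[\boldsymbol{\alpha}],\varphi'[\boldsymbol{\alpha}]$: $\mathcal{T}\text{ -DD}(\varphi)=\mathcal{T}\text{ -DD}(\varphi')$ iff $\varphi\equiv_{\mathcal{T}}\varphi'$. -}

module Defs where

open import Data.Bool using (Bool; true; false; if_then_else_)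
open import Data.List using (List; []; _∷_; map; foldr; _++_)
open import Data.List.Membership.Propositional using (_∈_)
open import Data.List.Relation.Unary.All using (All)
open import Data.List.Relation.Unary.Unique.Propositional using (Unique)
open import Data.Product using (Σ; _×_; _,_; proj₂)
open import Data.Empty using (⊥)
open import Function.Bundles using (_⇔_)
open import Relation.Binary.PropositionalEquality using (_≡_)
open import Relation.Binary.Definitions using (DecidableEquality)
open import Relation.Nullary using (¬_; yes; no)

-- Atoms of type `Atom` are the T-atoms; via the
-- bijection T2B we identify each T-atom with its Boolean abstraction, so a
-- single syntax serves both for T-formulas φ and their abstractions φᵖ
-- (T2B and B2T are the identity on this syntax).

data Form (Atom : Set) : Set where
  var   : Atom → Form Atom
  tt ff : Form Atom
  ¬'_   : Form Atom → Form Atom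
  _∧'_  : Form Atom → Form Atom → Form Atom
  _∨'_  : Form Atom → Form Atom → Form Atom

infixr 6 _∧'_
infixr 5 _∨'_

module _ {Atom : Set} where

  atoms : Form Atom → List Atom
  atoms (var a)  = a ∷ []
  atoms tt       = []
  atoms ff       = []
  atoms (¬' φ)   = atoms φ
  atoms (φ ∧' ψ) = atoms φ ++ atoms ψ
  atoms (φ ∨' ψ) = atoms φ ++ atoms ψ

  Over : Form Atom → List Atom → Set
  Over φ α = All (_∈ α) (atoms φ)

  Disjoint : List Atom → List Atom → Set
  Disjoint α β = ∀ {a} → a ∈ α → a ∈ β → ⊥

  evalB : (Atom → Bool) → Form Atom → Bool
  evalB μ (var a)  = μ a
  evalB μ tt       = true
  evalB μ ff       = false
  evalB μ (¬' φ)   = if evalB μ φ then false else true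
  evalB μ (φ ∧' ψ) = if evalB μ φ then evalB μ ψ else false
  evalB μ (φ ∨' ψ) = if evalB μ φ then true else evalB μ ψ

  _≡B_ : Form Atom → Form Atom → Set
  φ ≡B ψ = ∀ μ → evalB μ φ ≡ evalB μ ψ

  subst : DecidableEquality Atom → Atom → Bool → Form Atom → Form Atom
  subst _≟_ b x (var a) with a ≟ b
  ... | yes _ = if x then tt else ff
  ... | no  _ = var a
  subst _≟_ b x tt       = tt
  subst _≟_ b x ff       = ff
  subst _≟_ b x (¬' φ)   = ¬' subst _≟_ b x φ
  subst _≟_ b x (φ ∧' ψ) = subst _≟_ b x φ ∧' subst _≟_ b x ψ
  subst _≟_ b x (φ ∨' ψ) = subst _≟_ b x φ ∨' subst _≟_ b x ψ

  ∃B : DecidableEquality Atom → List Atom → Form Atom → Form Atom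
  ∃B _≟_ []       φ = φ
  ∃B _≟_ (b ∷ bs) φ = ∃B _≟_ bs (subst _≟_ b true φ ∨' subst _≟_ b false φ)

Lit : Set → Set
Lit Atom = Bool × Atom      -- (true , a) is a, (false , a) is ¬a

module _ {Atom : Set} where

  litForm : Lit Atom → Form Atom
  litForm (b , a) = if b then var a else ¬' var a

Clause : Set → Set
Clause Atom = List (Lit Atom)

Assignment : Set → Set
Assignment Atom = List (Lit Atom)

module _ {Atom : Set} where

  clauseForm : Clause Atom → Form Atom
  clauseForm = foldr (λ l φ → litForm l ∨' φ) ff

  assignForm : Assignment Atom → Form Atom
  assignForm = foldr (λ l φ → litForm l ∧' φ) tt

  bigAnd : List (Form Atom) → Form Atom
  bigAnd = foldr _∧'_ tt

  Total : List Atom → Assignment Atom → Set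
  Total α ρ = (∀ a → a ∈ α → a ∈ map proj₂ ρ)
            × All (_∈ α) (map proj₂ ρ)
            × Unique (map proj₂ ρ)

  PropSat : Assignment Atom → Form Atom → Set
  PropSat ρ φ = ∀ μ → evalB μ (assignForm ρ) ≡ true → evalB μ φ ≡ true

record Theory (Atom : Set) : Set₁ where
  field
    Model : Set
    val   : Model → Atom → Bool

module _ {Atom : Set} (T : Theory Atom) where
  open Theory T

  _≡T_ : Form Atom → Form Atom → Set
  φ ≡T ψ = ∀ M → evalB (val M) φ ≡ evalB (val M) ψ

  TValid : Form Atom → Set
  TValid φ = ∀ M → evalB (val M) φ ≡ true

  TLemma : Clause Atom → Set
  TLemma C = TValid (clauseForm C)

  TInconsistent : Assignment Atom → Set
  TInconsistent ρ = ∀ M → evalB (val M) (assignForm ρ) ≡ false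

  TTA¬T : List Atom → Form Atom → Assignment Atom → Set
  TTA¬T α φ ρ = Total α ρ × TInconsistent ρ × PropSat ρ φ

  RulesOut : (Assignment Atom → Set) → List (Clause Atom) → Set
  RulesOut S Cs = ∀ μ → ¬ (Σ (Assignment Atom) λ ρ → S ρ
                              × evalB μ (assignForm ρ) ≡ true
                              × evalB μ (bigAnd (map clauseForm Cs)) ≡ true)

  IsTLEMMAS : (List Atom → List Atom → Form Atom → List (Clause Atom)) → Set
  IsTLEMMAS TL = ∀ α β φ → Over φ α → Disjoint α β →
      All (λ C → All (_∈ α ++ β) (map proj₂ C) × TLemma C) (TL α β φ)
    × RulesOut (TTA¬T α φ) (TL α β φ)

record CanonicalDD (Atom : Set) : Set₁ where
  field
    K     : List Atom → Set
    DD    : Set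
    build : (A : List Atom) → K A → Form Atom → DD
    canonical : ∀ A (k : K A) φ ψ → Over φ A → Over ψ A →
                (build A k φ ≡ build A k ψ) ⇔ (φ ≡B ψ)

module _ {Atom : Set} (_≟_ : DecidableEquality Atom) (D : CanonicalDD Atom)
         (TL : List Atom → List Atom → Form Atom → List (Clause Atom)) where
  open CanonicalDD D

  TDD : (α β : List Atom) → K α → Form Atom → DD
  TDD α β k φ = build α k (φ ∧' ∃B _≟_ β (bigAnd (map clauseForm (TL α β φ))))

  TCanonical : Theory Atom → (α β : List Atom) → K α → Set
  TCanonical T α β k = ∀ φ ψ → Over φ α → Over ψ α →
    (TDD α β k φ ≡ TDD α β k ψ) ⇔ (_≡T_ T φ ψ)

-- The conjunct ∃B.⋀ Cᵖ is T-valid (every model of T satisfies the T-lemmas,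
-- whatever the values of the β-atoms), so φ ∧ ∃B.⋀ Cᵖ ≡T φ; hence equal
-- diagrams force φ ≡T ψ.  Conversely, a Boolean assignment μ satisfying
-- φ ∧ ∃B.⋀ Cᵖ restricts to a T-consistent total assignment on α: otherwise
-- the restriction would be one of the assignments ruled out by the lemmas,
-- yet extended on β it satisfies them.  On α-formulas, T-equivalent formulas
-- agree at every such μ, and ∃B.⋀ Cᵖ ≡T ⊤ is itself an α-formula, so
-- φ ≡T ψ makes φ ∧ ∃B.⋀ Cᵖ and ψ ∧ ∃B.⋀ C'ᵖ propositionally equivalent, and
-- canonicity of the Boolean diagrams gives equal T-diagrams.
module Submission where

open import Defs
open import Data.Bool using (Bool; true; false)
open import Data.Bool.Properties using (¬-not; ⇔→≡) renaming (_≟_ to _≟ᵇ_)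
open import Data.List using (List; []; _∷_; map; _++_; deduplicate)
open import Data.List.Membership.Propositional using (_∈_; _∉_)
open import Data.List.Membership.Propositional.Properties
  using (∈-++⁻; ∈-deduplicate⁺; ∈-deduplicate⁻)
open import Data.List.Relation.Unary.All as All using (All; []; _∷_)
open import Data.List.Relation.Unary.All.Properties using (++⁺; ++⁻; map⁺)
open import Data.List.Relation.Unary.Any using (here; there)
open import Data.List.Relation.Unary.Unique.DecPropositional.Properties using (deduplicate-!)
open import Data.Product using (Σ; _×_; _,_; proj₁; proj₂)
open import Data.Sum using (_⊎_; inj₁; inj₂; [_,_]′)
open import Function.Bundles using (_⇔_; mk⇔; Equivalence)
open import Relation.Binary.PropositionalEquality
  using (_≡_; _≢_; refl; sym; trans; cong; module ≡-Reasoning)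
open import Relation.Binary.Definitions using (DecidableEquality)
open import Relation.Nullary using (¬_; yes; no; contradiction)
open import Relation.Nullary.Decidable using (decidable-stable)

module _ {Atom : Set} where

  Agree : List Atom → (Atom → Bool) → (Atom → Bool) → Set
  Agree S μ ν = ∀ {a} → a ∈ S → μ a ≡ ν a

  evalB-cong : ∀ {S μ ν} φ → Over φ S → Agree S μ ν → evalB μ φ ≡ evalB ν φ
  evalB-cong (var a)  (a∈S ∷ []) μ≈ν = μ≈ν a∈S
  evalB-cong tt       _          _   = refl
  evalB-cong ff       _          _   = refl
  evalB-cong (¬' φ)   φ/S        μ≈ν rewrite evalB-cong φ φ/S μ≈ν = refl
  evalB-cong (φ ∧' ψ) φψ/S       μ≈ν
    rewrite evalB-cong φ (proj₁ (++⁻ (atoms φ) φψ/S)) μ≈ν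
          | evalB-cong ψ (proj₂ (++⁻ (atoms φ) φψ/S)) μ≈ν = refl
  evalB-cong (φ ∨' ψ) φψ/S       μ≈ν
    rewrite evalB-cong φ (proj₁ (++⁻ (atoms φ) φψ/S)) μ≈ν
          | evalB-cong ψ (proj₂ (++⁻ (atoms φ) φψ/S)) μ≈ν = refl

  ∧'-true⁻ : ∀ (μ : Atom → Bool) φ ψ → evalB μ (φ ∧' ψ) ≡ true → evalB μ φ ≡ true × evalB μ ψ ≡ true
  ∧'-true⁻ μ φ ψ e with evalB μ φ
  ... | true = refl , e

  ∧'-true⁺ : ∀ (μ : Atom → Bool) φ ψ → evalB μ φ ≡ true → evalB μ ψ ≡ true → evalB μ (φ ∧' ψ) ≡ true
  ∧'-true⁺ μ φ ψ φ-true ψ-true rewrite φ-true = ψ-true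

  ∧'-identityʳ : ∀ (μ : Atom → Bool) φ ψ → evalB μ ψ ≡ true → evalB μ (φ ∧' ψ) ≡ evalB μ φ
  ∧'-identityʳ μ φ ψ ψ-true rewrite ψ-true with evalB μ φ
  ... | true  = refl
  ... | false = refl

  ∨'-true⇔ : ∀ (μ : Atom → Bool) φ ψ →
             evalB μ (φ ∨' ψ) ≡ true ⇔ (evalB μ φ ≡ true ⊎ evalB μ ψ ≡ true)
  ∨'-true⇔ μ φ ψ with evalB μ φ
  ... | true  = mk⇔ inj₁ (λ _ → refl)
  ... | false = mk⇔ inj₂ [ (λ ()) , (λ e → e) ]′

  litForm-Over : ∀ {S} (l : Lit Atom) → proj₂ l ∈ S → Over (litForm l) S
  litForm-Over (true  , a) a∈S = a∈S ∷ []
  litForm-Over (false , a) a∈S = a∈S ∷ []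

  clauseForm-Over : ∀ {S} (C : Clause Atom) → All (_∈ S) (map proj₂ C) → Over (clauseForm C) S
  clauseForm-Over []      []         = []
  clauseForm-Over (l ∷ C) (l∈S ∷ C/S) = ++⁺ (litForm-Over l l∈S) (clauseForm-Over C C/S)

  bigAnd-Over : ∀ {S} (φs : List (Form Atom)) → All (λ φ → Over φ S) φs → Over (bigAnd φs) S
  bigAnd-Over []       []            = []
  bigAnd-Over (φ ∷ φs) (φ/S ∷ φs/S) = ++⁺ φ/S (bigAnd-Over φs φs/S)

  bigAnd-true : ∀ {μ} (φs : List (Form Atom)) → All (λ φ → evalB μ φ ≡ true) φs →
                evalB μ (bigAnd φs) ≡ true
  bigAnd-true []       []               = refl
  bigAnd-true (φ ∷ φs) (φ-true ∷ φs-true) rewrite φ-true = bigAnd-true φs φs-true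

  assignmentOf : (Atom → Bool) → List Atom → Assignment Atom
  assignmentOf μ []      = []
  assignmentOf μ (a ∷ γ) = (μ a , a) ∷ assignmentOf μ γ

  assignmentOf-atoms : ∀ μ γ → map proj₂ (assignmentOf μ γ) ≡ γ
  assignmentOf-atoms μ []      = refl
  assignmentOf-atoms μ (a ∷ γ) = cong (a ∷_) (assignmentOf-atoms μ γ)

  litForm-true⇔ : ∀ (ν : Atom → Bool) x a → evalB ν (litForm (x , a)) ≡ true ⇔ ν a ≡ x
  litForm-true⇔ ν true  a = mk⇔ (λ e → e) (λ e → e)
  litForm-true⇔ ν false a with ν a
  ... | true  = mk⇔ (λ ()) (λ ())
  ... | false = mk⇔ (λ _ → refl) (λ _ → refl)

  assignmentOf-true⇔ : ∀ ν μ γ → evalB ν (assignForm (assignmentOf μ γ)) ≡ true ⇔ Agree γ ν μ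
  assignmentOf-true⇔ ν μ γ = mk⇔ (to γ) (from γ)
    where
      to : ∀ γ → evalB ν (assignForm (assignmentOf μ γ)) ≡ true → Agree γ ν μ
      to (a ∷ γ) e (here refl) =
        Equivalence.to (litForm-true⇔ ν (μ a) a)
                       (proj₁ (∧'-true⁻ ν (litForm (μ a , a)) (assignForm (assignmentOf μ γ)) e))
      to (a ∷ γ) e (there b∈γ) =
        to γ (proj₂ (∧'-true⁻ ν (litForm (μ a , a)) (assignForm (assignmentOf μ γ)) e)) b∈γ
      from : ∀ γ → Agree γ ν μ → evalB ν (assignForm (assignmentOf μ γ)) ≡ true
      from []      _   = refl
      from (a ∷ γ) ν≈μ = ∧'-true⁺ ν (litForm (μ a , a)) (assignForm (assignmentOf μ γ))
        (Equivalence.from (litForm-true⇔ ν (μ a) a) (ν≈μ (here refl)))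
        (from γ (λ b∈γ → ν≈μ (there b∈γ)))

module _ {Atom : Set} (_≟_ : DecidableEquality Atom) where

  update : (Atom → Bool) → Atom → Bool → Atom → Bool
  update μ b x a with a ≟ b
  ... | yes _ = x
  ... | no  _ = μ a

  evalB-subst : ∀ μ b x φ → evalB μ (subst _≟_ b x φ) ≡ evalB (update μ b x) φ
  evalB-subst μ b x (var a) with a ≟ b
  evalB-subst μ b true  (var a) | yes _ = refl
  evalB-subst μ b false (var a) | yes _ = refl
  ... | no _ = refl
  evalB-subst μ b x tt       = refl
  evalB-subst μ b x ff       = refl
  evalB-subst μ b x (¬' φ)   rewrite evalB-subst μ b x φ = refl
  evalB-subst μ b x (φ ∧' ψ) rewrite evalB-subst μ b x φ | evalB-subst μ b x ψ = refl
  evalB-subst μ b x (φ ∨' ψ) rewrite evalB-subst μ b x φ | evalB-subst μ b x ψ = refl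

  evalB-subst-self : ∀ μ b φ → evalB μ (subst _≟_ b (μ b) φ) ≡ evalB μ φ
  evalB-subst-self μ b (var a) with a ≟ b
  ... | no _ = refl
  ... | yes refl with μ a
  ...   | true  = refl
  ...   | false = refl
  evalB-subst-self μ b tt       = refl
  evalB-subst-self μ b ff       = refl
  evalB-subst-self μ b (¬' φ)   rewrite evalB-subst-self μ b φ = refl
  evalB-subst-self μ b (φ ∧' ψ) rewrite evalB-subst-self μ b φ | evalB-subst-self μ b ψ = refl
  evalB-subst-self μ b (φ ∨' ψ) rewrite evalB-subst-self μ b φ | evalB-subst-self μ b ψ = refl

  subst-atoms : ∀ {P : Atom → Set} b x φ → All P (atoms φ) →
                All (λ a → P a × a ≢ b) (atoms (subst _≟_ b x φ))
  subst-atoms b x (var a) (pa ∷ []) with a ≟ b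
  subst-atoms b true  (var a) _ | yes _ = []
  subst-atoms b false (var a) _ | yes _ = []
  ... | no a≢b = (pa , a≢b) ∷ []
  subst-atoms b x tt       _   = []
  subst-atoms b x ff       _   = []
  subst-atoms b x (¬' φ)   Pφ  = subst-atoms b x φ Pφ
  subst-atoms b x (φ ∧' ψ) Pφψ =
    ++⁺ (subst-atoms b x φ (proj₁ (++⁻ (atoms φ) Pφψ))) (subst-atoms b x ψ (proj₂ (++⁻ (atoms φ) Pφψ)))
  subst-atoms b x (φ ∨' ψ) Pφψ =
    ++⁺ (subst-atoms b x φ (proj₁ (++⁻ (atoms φ) Pφψ))) (subst-atoms b x ψ (proj₂ (++⁻ (atoms φ) Pφψ)))

  ∃B-atoms : ∀ {P : Atom → Set} bs φ → All P (atoms φ) →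
             All (λ a → P a × a ∉ bs) (atoms (∃B _≟_ bs φ))
  ∃B-atoms []       φ Pφ = All.map (λ pa → pa , λ ()) Pφ
  ∃B-atoms (b ∷ bs) φ Pφ =
    All.map (λ { ((pa , a≢b) , a∉bs) → pa , λ { (here a≡b) → a≢b a≡b ; (there a∈bs) → a∉bs a∈bs } })
            (∃B-atoms bs _ (++⁺ (subst-atoms b true φ Pφ) (subst-atoms b false φ Pφ)))

  ∃B-Over : ∀ α β φ → Over φ (α ++ β) → Over (∃B _≟_ β φ) α
  ∃B-Over α β φ φ/αβ = All.map in-α (∃B-atoms β φ φ/αβ)
    where
      in-α : ∀ {a} → a ∈ α ++ β × a ∉ β → a ∈ α
      in-α (a∈αβ , a∉β) with ∈-++⁻ α a∈αβ
      ... | inj₁ a∈α = a∈α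
      ... | inj₂ a∈β = contradiction a∈β a∉β

  Shannon-true⇔ : ∀ μ b φ → evalB μ (subst _≟_ b true φ ∨' subst _≟_ b false φ) ≡ true ⇔
                  (Σ Bool λ x → evalB μ (subst _≟_ b x φ) ≡ true)
  Shannon-true⇔ μ b φ = mk⇔
    (λ e → [ (true ,_) , (false ,_) ]′ (Equivalence.to cases e))
    (λ { (true , e) → Equivalence.from cases (inj₁ e) ; (false , e) → Equivalence.from cases (inj₂ e) })
    where
      cases : evalB μ (subst _≟_ b true φ ∨' subst _≟_ b false φ) ≡ true ⇔
              (evalB μ (subst _≟_ b true φ) ≡ true ⊎ evalB μ (subst _≟_ b false φ) ≡ true)
      cases = ∨'-true⇔ μ (subst _≟_ b true φ) (subst _≟_ b false φ)

  ∃B-intro : ∀ μ bs φ → evalB μ φ ≡ true → evalB μ (∃B _≟_ bs φ) ≡ true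
  ∃B-intro μ []       φ φ-true = φ-true
  ∃B-intro μ (b ∷ bs) φ φ-true = ∃B-intro μ bs _
    (Equivalence.from (Shannon-true⇔ μ b φ) (μ b , trans (evalB-subst-self μ b φ) φ-true))

  ∃B-elim : ∀ μ bs φ → evalB μ (∃B _≟_ bs φ) ≡ true →
            Σ (Atom → Bool) λ μ' → (∀ {a} → a ∉ bs → μ' a ≡ μ a) × evalB μ' φ ≡ true
  ∃B-elim μ []       φ e = μ , (λ _ → refl) , e
  ∃B-elim μ (b ∷ bs) φ e
    with μ'' , μ''≈μ , e'' ← ∃B-elim μ bs (subst _≟_ b true φ ∨' subst _≟_ b false φ) e
    with x , e-x ← Equivalence.to (Shannon-true⇔ μ'' b φ) e'' =
    update μ'' b x , agree , trans (sym (evalB-subst μ'' b x φ)) e-x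
    where
      agree : ∀ {a} → a ∉ b ∷ bs → update μ'' b x a ≡ μ a
      agree {a} a∉ with a ≟ b
      ... | yes a≡b = contradiction (here a≡b) a∉
      ... | no  _   = μ''≈μ (λ a∈bs → a∉ (there a∈bs))

  -- α is deduplicated so that the assignment is Unique, as Total requires
  restriction : (Atom → Bool) → List Atom → Assignment Atom
  restriction μ α = assignmentOf μ (deduplicate _≟_ α)

  restriction-Total : ∀ μ α → Total α (restriction μ α)
  restriction-Total μ α rewrite assignmentOf-atoms μ (deduplicate _≟_ α) =
    (λ _ a∈α → ∈-deduplicate⁺ _≟_ a∈α) ,
    All.tabulate (∈-deduplicate⁻ _≟_ α) ,
    deduplicate-! _≟_ α

  restriction-true⇔ : ∀ ν μ α → evalB ν (assignForm (restriction μ α)) ≡ true ⇔ Agree α ν μ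
  restriction-true⇔ ν μ α = mk⇔
    (λ e {a} a∈α → Equivalence.to (assignmentOf-true⇔ ν μ _) e (∈-deduplicate⁺ _≟_ a∈α))
    (λ ν≈μ → Equivalence.from (assignmentOf-true⇔ ν μ _) (λ {a} a∈ → ν≈μ (∈-deduplicate⁻ _≟_ α a∈)))

  module _ (T : Theory Atom) where
    open Theory T

    ≡T⇒≡-at-consistent : ∀ {μ} α φ ψ → Over φ α → Over ψ α → _≡T_ T φ ψ →
                         ¬ TInconsistent T (restriction μ α) → evalB μ φ ≡ evalB μ ψ
    -- If the values differed, no model could agree with μ on α, i.e. the restriction
    -- would be T-inconsistent; equality of Booleans is decidable, so this suffices.
    ≡T⇒≡-at-consistent {μ} α φ ψ φ/α ψ/α φ≡Tψ consistent =
      decidable-stable (evalB μ φ ≟ᵇ evalB μ ψ) λ φ≢ψ →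
        consistent λ M → ¬-not λ M⊨ρ →
          φ≢ψ (at-agreeing-model M (Equivalence.to (restriction-true⇔ (val M) μ α) M⊨ρ))
      where
        open ≡-Reasoning
        at-agreeing-model : ∀ M → Agree α (val M) μ → evalB μ φ ≡ evalB μ ψ
        at-agreeing-model M M≈μ = begin
          evalB μ φ       ≡⟨ evalB-cong φ φ/α (λ a∈ → sym (M≈μ a∈)) ⟩
          evalB (val M) φ ≡⟨ φ≡Tψ M ⟩
          evalB (val M) ψ ≡⟨ evalB-cong ψ ψ/α M≈μ ⟩
          evalB μ ψ       ∎

    module ProjectedLemmas
             (TL : List Atom → List Atom → Form Atom → List (Clause Atom))
             (isTL : IsTLEMMAS T TL) (α β : List Atom) (α#β : Disjoint α β) where

      lemmas : Form Atom → Form Atom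
      lemmas φ = bigAnd (map clauseForm (TL α β φ))

      projectedLemmas : Form Atom → Form Atom
      projectedLemmas φ = ∃B _≟_ β (lemmas φ)

      lemmas-Over : ∀ φ → Over φ α → Over (lemmas φ) (α ++ β)
      lemmas-Over φ φ/α = bigAnd-Over _ (map⁺ (All.map (λ {C} (C/αβ , _) → clauseForm-Over C C/αβ)
                                                       (proj₁ (isTL α β φ φ/α α#β))))

      lemmas-valid : ∀ φ → Over φ α → TValid T (lemmas φ)
      lemmas-valid φ φ/α M = bigAnd-true _ (map⁺ (All.map (λ (_ , C-valid) → C-valid M)
                                                          (proj₁ (isTL α β φ φ/α α#β))))

      projectedLemmas-Over : ∀ φ → Over φ α → Over (projectedLemmas φ) α
      projectedLemmas-Over φ φ/α = ∃B-Over α β (lemmas φ) (lemmas-Over φ φ/α)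

      projectedLemmas-valid : ∀ φ → Over φ α → TValid T (projectedLemmas φ)
      projectedLemmas-valid φ φ/α M = ∃B-intro (val M) β (lemmas φ) (lemmas-valid φ φ/α M)

      conj-Over : ∀ φ → Over φ α → Over (φ ∧' projectedLemmas φ) α
      conj-Over φ φ/α = ++⁺ φ/α (projectedLemmas-Over φ φ/α)

      conj-≡T : ∀ φ → Over φ α → _≡T_ T (φ ∧' projectedLemmas φ) φ
      conj-≡T φ φ/α M = ∧'-identityʳ (val M) φ (projectedLemmas φ) (projectedLemmas-valid φ φ/α M)

      conj-true⇒consistent : ∀ φ → Over φ α → ∀ μ → evalB μ (φ ∧' projectedLemmas φ) ≡ true →
                             ¬ TInconsistent T (restriction μ α)
      conj-true⇒consistent φ φ/α μ e inconsistent
        with φ-true , ∃-true ← ∧'-true⁻ μ φ (projectedLemmas φ) e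
        with μ' , μ'≈μ , lemmas-true ← ∃B-elim μ β (lemmas φ) ∃-true =
        proj₂ (isTL α β φ φ/α α#β) μ'
          (restriction μ α , (restriction-Total μ α , inconsistent , sat-φ) , sat-μ' , lemmas-true)
        where
          sat-φ : PropSat (restriction μ α) φ
          sat-φ ν ν⊨ρ = trans (evalB-cong φ φ/α (Equivalence.to (restriction-true⇔ ν μ α) ν⊨ρ)) φ-true
          sat-μ' : evalB μ' (assignForm (restriction μ α)) ≡ true
          sat-μ' = Equivalence.from (restriction-true⇔ μ' μ α) (λ a∈α → μ'≈μ (α#β a∈α))

      ≡T⇒conj-⇒ : ∀ φ ψ → Over φ α → Over ψ α → _≡T_ T φ ψ → ∀ μ →
                  evalB μ (φ ∧' projectedLemmas φ) ≡ true → evalB μ (ψ ∧' projectedLemmas ψ) ≡ true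
      ≡T⇒conj-⇒ φ ψ φ/α ψ/α φ≡Tψ μ e = ∧'-true⁺ μ ψ (projectedLemmas ψ)
        (trans (sym (agree φ ψ φ/α ψ/α φ≡Tψ)) (proj₁ (∧'-true⁻ μ φ (projectedLemmas φ) e)))
        (agree (projectedLemmas ψ) tt (projectedLemmas-Over ψ ψ/α) [] (projectedLemmas-valid ψ ψ/α))
        where
          agree : ∀ χ χ' → Over χ α → Over χ' α → _≡T_ T χ χ' → evalB μ χ ≡ evalB μ χ'
          agree χ χ' χ/α χ'/α χ≡Tχ' =
            ≡T⇒≡-at-consistent α χ χ' χ/α χ'/α χ≡Tχ' (conj-true⇒consistent φ φ/α μ e)

theorem7 : {Atom : Set} (_≟_ : DecidableEquality Atom) (T : Theory Atom)
    (D : CanonicalDD Atom)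
    (TL : List Atom → List Atom → Form Atom → List (Clause Atom)) →
    IsTLEMMAS T TL →
    (α β : List Atom) → Disjoint α β → (k : CanonicalDD.K D α) →
    TCanonical _≟_ D TL T α β k
theorem7 _≟_ T D TL isTL α β α#β k φ ψ φ/α ψ/α = mk⇔ sound complete
  where
    open CanonicalDD D
    open Theory T
    open ProjectedLemmas _≟_ T TL isTL α β α#β
    open ≡-Reasoning
    DD-canonical : (build α k (φ ∧' projectedLemmas φ) ≡ build α k (ψ ∧' projectedLemmas ψ)) ⇔
                   ((φ ∧' projectedLemmas φ) ≡B (ψ ∧' projectedLemmas ψ))
    DD-canonical = canonical α k (φ ∧' projectedLemmas φ) (ψ ∧' projectedLemmas ψ)
                             (conj-Over φ φ/α) (conj-Over ψ ψ/α)

    sound : TDD _≟_ D TL α β k φ ≡ TDD _≟_ D TL α β k ψ → _≡T_ T φ ψ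
    sound same-DD M = begin
      evalB (val M) φ                          ≡⟨ sym (conj-≡T φ φ/α M) ⟩
      evalB (val M) (φ ∧' projectedLemmas φ)   ≡⟨ Equivalence.to DD-canonical same-DD (val M) ⟩
      evalB (val M) (ψ ∧' projectedLemmas ψ)   ≡⟨ conj-≡T ψ ψ/α M ⟩
      evalB (val M) ψ                          ∎

    complete : _≡T_ T φ ψ → TDD _≟_ D TL α β k φ ≡ TDD _≟_ D TL α β k ψ
    complete φ≡Tψ = Equivalence.from DD-canonical λ μ → ⇔→≡ (mk⇔
      (≡T⇒conj-⇒ φ ψ φ/α ψ/α φ≡Tψ μ)
      (≡T⇒conj-⇒ ψ φ ψ/α φ/α (λ M → sym (φ≡Tψ M)) μ))
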